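{- Fix $\mathbf r\in\mathbb N^I$, $\mathbf c\in\mathbb N^J$ with $\sum_i r_i=\sum_j c_j$. Let $\mathcal P=\{\mathbf g_1,\dots,\mathbf g_N\}$ and $\hat{\mathcal P}=\{\hat{\mathbf g}_1,\dots,\hat{\mathbf g}_N\}$ be two proper multisets with $\sum_{l}\mathbf g_l=\sum_l\hat{\mathbf g}_l$, and suppose $\mathbf g_k\ne\hat{\mathbf g}_{k'}$ for some $k,k'$. Then the size of differences $D_{\mathbf g_k,\hat{\mathbf g}_{k'}}$ can be decreased by a swap operation among two graphs of $\mathcal P$ (one of which is $\mathbf g_k$), such that if the resulting multiset is not proper, then it is improper and its improper graph and its $k$-th graph form a resolvable pair.
   Context: A proper graph is a nonnegative integer $I\times J$ matrix with row sums $\mathbf r$ and column sums $\mathbf c$. An improper graph is an integer $I\times J$ matrix with row sums $\mathbf r$ and column sums $\mathbf c$ having exactly one entry $(i^*,j^*)$ (the improper edge) equal to $-1$ and all other entries nonnegative. A multiset of $N$ matrices is proper if every element is a proper graph, and improper if exactly one element is an improper graph, the others are proper graphs, and the entrywise sum of all elements is nonnegative. For an improper multiset with improper graph $\mathbf g_{k_{\mathrm{im}}}$ and improper edge $(i^*,j^*)$, a resolvable pair is $[k_{\mathrm{im}},k_{\mathrm{pr}}]$ where $k_{\mathrm{pr}}\ne k_{\mathrm{im}}$ and $g_{k_{\mathrm{pr}}}(i^*j^*)>0$. For $I\times J$ matrices, $D_{\mathbf g,\hat{\mathbf g}}=\sum_{i,j}|g(ij)-\hat g(ij)|$. A swap operation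 among $\mathbf g_{k_1},\mathbf g_{k_2}$ replaces them by $\mathbf g_{k_1}+Z$ and $\mathbf g_{k_2}-Z$, where $Z$ is a sum of finitely many matrices each having $+1$ in an entry $(i_2,j)$, $-1$ in an entry $(i_1,j)$ of the same column $j$, and $0$ elsewhere; other elements are unchanged. -}

module Defs where

open import Data.Nat as ℕ using (ℕ)
open import Data.Integer as ℤ using (ℤ; +_; _+_; _-_; -_; _≤_; _<_; ∣_∣)
open import Data.Fin using (Fin; zero; suc; _≟_)
open import Data.Product using (_×_; ∃-syntax)
open import Relation.Nullary using (¬_; yes; no)
open import Relation.Binary.PropositionalEquality using (_≡_; _≢_)

sumℤ : ∀ n → (Fin n → ℤ) → ℤ
sumℤ ℕ.zero    f = + 0
sumℤ (ℕ.suc n) f = f zero + sumℤ n (λ i → f (suc i))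

sumℕ : ∀ n → (Fin n → ℕ) → ℕ
sumℕ ℕ.zero    f = 0
sumℕ (ℕ.suc n) f = f zero ℕ.+ sumℕ n (λ i → f (suc i))

Matrix : ℕ → ℕ → Set
Matrix I J = Fin I → Fin J → ℤ

_⊕_ : ∀ {I J} → Matrix I J → Matrix I J → Matrix I J
(A ⊕ B) i j = A i j + B i j

_⊖_ : ∀ {I J} → Matrix I J → Matrix I J → Matrix I J
(A ⊖ B) i j = A i j - B i j

sumMat : ∀ {I J} N → (Fin N → Matrix I J) → Matrix I J
sumMat N P i j = sumℤ N (λ l → P l i j)

HasMargins : ∀ {I J} → (Fin I → ℕ) → (Fin J → ℕ) → Matrix I J → Set
HasMargins {I} {J} r c g =
  (∀ i → sumℤ J (λ j → g i j) ≡ + r i) × (∀ j → sumℤ I (λ i → g i j) ≡ + c j)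

Proper : ∀ {I J} → (Fin I → ℕ) → (Fin J → ℕ) → Matrix I J → Set
Proper r c g = HasMargins r c g × (∀ i j → + 0 ≤ g i j)

Improper : ∀ {I J} → (Fin I → ℕ) → (Fin J → ℕ) → Matrix I J → Fin I → Fin J → Set
Improper r c g i* j* =
  HasMargins r c g × (g i* j* ≡ - (+ 1)) ×
  (∀ i j → ¬ (i ≡ i* × j ≡ j*) → + 0 ≤ g i j)

-- multisets of N graphs, represented as indexed families
ProperMS : ∀ {I J N} → (Fin I → ℕ) → (Fin J → ℕ) → (Fin N → Matrix I J) → Set
ProperMS r c P = ∀ k → Proper r c (P k)

ImproperMS : ∀ {I J N} → (Fin I → ℕ) → (Fin J → ℕ) → (Fin N → Matrix I J) →
             Fin N → Fin I → Fin J → Set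
ImproperMS {N = N} r c P kim i* j* =
  Improper r c (P kim) i* j* × (∀ k → k ≢ kim → Proper r c (P k)) ×
  (∀ i j → + 0 ≤ sumMat N P i j)

Resolvable : ∀ {I J N} → (Fin N → Matrix I J) → Fin N → Fin I → Fin J → Fin N → Set
Resolvable P kim i* j* kpr = kpr ≢ kim × + 0 < P kpr i* j*

D : ∀ {I J} → Matrix I J → Matrix I J → ℕ
D {I} {J} g h = sumℕ I (λ i → sumℕ J (λ j → ∣ g i j - h i j ∣))

elem : ∀ {I J} → Fin I → Fin I → Fin J → Matrix I J
elem i₁ i₂ j i j' with j' ≟ j
... | no _ = + 0
... | yes _ with i ≟ i₂ | i ≟ i₁
...   | yes _ | _     = + 1
...   | no _  | yes _ = - (+ 1)
...   | no _  | no _  = + 0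

data ColMoveSum {I J : ℕ} : Matrix I J → Set where
  none : ColMoveSum (λ _ _ → + 0)
  step : ∀ {Z} (i₁ i₂ : Fin I) (j : Fin J) → i₁ ≢ i₂ →
         ColMoveSum Z → ColMoveSum (Z ⊕ elem i₁ i₂ j)

swap : ∀ {I J N} → (Fin N → Matrix I J) → Fin N → Fin N → Matrix I J → Fin N → Matrix I J
swap P k₁ k₂ Z l with l ≟ k₁
... | yes _ = P k₁ ⊕ Z
... | no _ with l ≟ k₂
...   | yes _ = P k₂ ⊖ Z
...   | no _  = P l

module Submission where

-- Write H for the target graph P̂ k′.  Since P k ≠ H and both have the same column sums,
-- some entry (i₁, j₁) has P k i₁ j₁ < H i₁ j₁.  Equal column-j₁ sums give a row i₂ with
-- H i₂ j₁ < P k i₂ j₁, equal row-i₁ sums give a column j₂ with H i₁ j₂ < P k i₁ j₂, and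
-- equal totals of the two multisets give a graph k₂ ≠ k with P k₂ i₁ j₁ > 0.  The swap uses
-- the rectangle move Z, which is +1 at (i₁,j₁) and (i₂,j₂) and -1 at (i₂,j₁) and (i₁,j₂):
--   * Z is a sum of two elementary column moves and has vanishing row and column sums,
--     so P k + Z and P k₂ - Z keep the margins;
--   * P k + Z moves three entries one step towards H and the fourth at most one step
--     away, so the ℓ¹ distance D to H drops;
--   * P k + Z is nonnegative, and P k₂ - Z can only become negative at (i₂,j₂), where
--     P k + Z is positive: this is the improper edge and it is resolvable with graph k.

open import Defs
open import Data.Nat using (ℕ; _<_)
open import Data.Integer using (ℤ)
open import Data.Fin using (Fin)
open import Data.Product using (_×_; ∃-syntax)
open import Relation.Nullary using (¬_)
open import Relation.Binary.PropositionalEquality using (_≡_; _≢_)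

open import Data.Nat as ℕ using (zero; suc)
import Data.Nat.Properties as ℕP
open import Data.Integer using (+_; -[1+_]; +≤+; +<+; -≤+; ∣_∣)
  renaming (_+_ to _+ᶻ_; _-_ to _-ᶻ_; -_ to -ᶻ_; _≤_ to _≤ᶻ_; _<_ to _<ᶻ_)
import Data.Integer.Properties as ℤP
open import Data.Integer.Tactic.RingSolver using (solve-∀)
open import Data.Fin using (_≟_) renaming (zero to fzero; suc to fsuc)
import Data.Fin.Properties as FinP
open import Data.Product using (_,_; proj₁; proj₂)
open import Data.Sum using (_⊎_; inj₁; inj₂)
open import Data.Empty using (⊥-elim)
open import Function using (_∘_)
open import Relation.Nullary using (yes; no; ¬?)
open import Relation.Nullary.Decidable using (_×-dec_)
open import Relation.Binary.Definitions using (tri<; tri≈; tri>)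
open import Relation.Binary.PropositionalEquality
  using (refl; sym; trans; cong; cong₂; subst; module ≡-Reasoning)
open import Algebra.Properties.CommutativeSemigroup ℤP.+-commutativeSemigroup
  using (interchange)

sumℤ-cong : ∀ n {f g : Fin n → ℤ} → (∀ x → f x ≡ g x) → sumℤ n f ≡ sumℤ n g
sumℤ-cong zero    f≗g = refl
sumℤ-cong (suc n) f≗g = cong₂ _+ᶻ_ (f≗g fzero) (sumℤ-cong n (f≗g ∘ fsuc))

sumℤ-zero : ∀ n → sumℤ n (λ _ → + 0) ≡ + 0
sumℤ-zero zero    = refl
sumℤ-zero (suc n) = trans (ℤP.+-identityˡ _) (sumℤ-zero n)

sumℤ-+ : ∀ n (f g : Fin n → ℤ) →
         sumℤ n (λ x → f x +ᶻ g x) ≡ sumℤ n f +ᶻ sumℤ n g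
sumℤ-+ zero    f g = refl
sumℤ-+ (suc n) f g =
  trans (cong (f fzero +ᶻ g fzero +ᶻ_) (sumℤ-+ n (f ∘ fsuc) (g ∘ fsuc)))
        (interchange (f fzero) (g fzero) (sumℤ n (f ∘ fsuc)) (sumℤ n (g ∘ fsuc)))

sumℤ-neg : ∀ n (f : Fin n → ℤ) → sumℤ n (λ x → -ᶻ f x) ≡ -ᶻ sumℤ n f
sumℤ-neg zero    f = refl
sumℤ-neg (suc n) f =
  trans (cong (-ᶻ f fzero +ᶻ_) (sumℤ-neg n (f ∘ fsuc)))
        (sym (ℤP.neg-distrib-+ (f fzero) (sumℤ n (f ∘ fsuc))))

sumℤ-- : ∀ n (f g : Fin n → ℤ) →
         sumℤ n (λ x → f x -ᶻ g x) ≡ sumℤ n f -ᶻ sumℤ n g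
sumℤ-- n f g = trans (sumℤ-+ n f (-ᶻ_ ∘ g)) (cong (sumℤ n f +ᶻ_) (sumℤ-neg n g))

sumℤ-mono : ∀ n {f g : Fin n → ℤ} → (∀ x → f x ≤ᶻ g x) → sumℤ n f ≤ᶻ sumℤ n g
sumℤ-mono zero    f≤g = ℤP.≤-refl
sumℤ-mono (suc n) f≤g = ℤP.+-mono-≤ (f≤g fzero) (sumℤ-mono n (f≤g ∘ fsuc))

sumℤ-< : ∀ n {f g : Fin n → ℤ} a → (∀ x → f x ≤ᶻ g x) → f a <ᶻ g a →
         sumℤ n f <ᶻ sumℤ n g
sumℤ-< (suc n) fzero    f≤g fa<ga = ℤP.+-mono-<-≤ fa<ga (sumℤ-mono n (f≤g ∘ fsuc))
sumℤ-< (suc n) (fsuc a) f≤g fa<ga = ℤP.+-mono-≤-< (f≤g fzero) (sumℤ-< n a (f≤g ∘ fsuc) fa<ga)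

sumℤ-concentrated : ∀ n (f : Fin n → ℤ) a → (∀ x → x ≢ a → f x ≡ + 0) → sumℤ n f ≡ f a
sumℤ-concentrated (suc n) f fzero    off =
  trans (cong (f fzero +ᶻ_) (trans (sumℤ-cong n (λ x → off (fsuc x) λ ()))
                                   (sumℤ-zero n)))
        (ℤP.+-identityʳ (f fzero))
sumℤ-concentrated (suc n) f (fsuc a) off =
  trans (cong₂ _+ᶻ_ (off fzero λ ())
                    (sumℤ-concentrated n (f ∘ fsuc) a (λ x x≢a → off (fsuc x) (x≢a ∘ FinP.suc-injective))))
        (ℤP.+-identityˡ _)

single : ∀ {n} → Fin n → ℤ → Fin n → ℤ
single a v x with x ≟ a
... | yes _ = v
... | no _  = + 0

δ : ∀ {n} → Fin n → Fin n → ℤ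
δ a = single a (+ 1)

single-here : ∀ {n} (a : Fin n) v → single a v a ≡ v
single-here a v with a ≟ a
... | yes _   = refl
... | no a≢a  = ⊥-elim (a≢a refl)

single-away : ∀ {n} {a x : Fin n} v → x ≢ a → single a v x ≡ + 0
single-away {a = a} {x} v x≢a with x ≟ a
... | yes x≡a = ⊥-elim (x≢a x≡a)
... | no _    = refl

sum-single : ∀ n (a : Fin n) v → sumℤ n (single a v) ≡ v
sum-single n a v =
  trans (sumℤ-concentrated n (single a v) a (λ x → single-away v)) (single-here a v)

≤-sum : ∀ n (f : Fin n → ℤ) a → (∀ x → + 0 ≤ᶻ f x) → f a ≤ᶻ sumℤ n f
≤-sum n f a f≥0 =
  ℤP.≤-trans (ℤP.≤-reflexive (sym (sum-single n a (f a)))) (sumℤ-mono n below)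
  where
  below : ∀ x → single a (f a) x ≤ᶻ f x
  below x with x ≟ a
  ... | yes refl = ℤP.≤-refl
  ... | no _     = f≥0 x

sum-≤ : ∀ n (f : Fin n → ℤ) a → (∀ x → x ≢ a → f x ≤ᶻ + 0) → sumℤ n f ≤ᶻ f a
sum-≤ n f a others≤0 =
  ℤP.≤-trans (sumℤ-mono n above) (ℤP.≤-reflexive (sum-single n a (f a)))
  where
  above : ∀ x → f x ≤ᶻ single a (f a) x
  above x with x ≟ a
  ... | yes refl = ℤP.≤-refl
  ... | no x≢a   = others≤0 x x≢a

compensating-index : ∀ n (f g : Fin n → ℤ) a → sumℤ n f ≡ sumℤ n g → f a <ᶻ g a →
                     ∃[ b ] g b <ᶻ f b
compensating-index n f g a same fa<ga with FinP.any? (λ b → g b ℤP.<? f b)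
... | yes found = found
... | no absent = ⊥-elim (ℤP.<-irrefl same
                    (sumℤ-< n a (λ b → ℤP.≮⇒≥ (λ gb<fb → absent (b , gb<fb))) fa<ga))

positive-other : ∀ n (f : Fin n → ℤ) a → f a <ᶻ sumℤ n f → ∃[ b ] (b ≢ a × + 0 <ᶻ f b)
positive-other n f a fa<sum with FinP.any? (λ b → ¬? (b ≟ a) ×-dec (+ 0 ℤP.<? f b))
... | yes found = found
... | no absent = ⊥-elim (ℤP.<-irrefl refl (ℤP.<-≤-trans fa<sum
                    (sum-≤ n f a (λ b b≢a → ℤP.≮⇒≥ (λ fb>0 → absent (b , b≢a , fb>0))))))

+sumℕ : ∀ n (f : Fin n → ℕ) → + sumℕ n f ≡ sumℤ n (λ x → + f x)
+sumℕ zero    f = refl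
+sumℕ (suc n) f = trans (ℤP.pos-+ (f fzero) _) (cong (+ f fzero +ᶻ_) (+sumℕ n (f ∘ fsuc)))

+D : ∀ {I J} (A H : Matrix I J) →
     + D A H ≡ sumℤ I (λ i → sumℤ J (λ j → + ∣ A i j -ᶻ H i j ∣))
+D {I} {J} A H = trans (+sumℕ I _) (sumℤ-cong I (λ i → +sumℕ J _))

i≤+∣i∣ : ∀ i → i ≤ᶻ + ∣ i ∣
i≤+∣i∣ (+ n)     = ℤP.≤-refl
i≤+∣i∣ -[1+ n ]  = -≤+

∣+∣-shift : ∀ x z → + 0 ≤ᶻ z ⊎ + 0 ≤ᶻ x +ᶻ z → + ∣ x +ᶻ z ∣ ≤ᶻ + ∣ x ∣ +ᶻ z
∣+∣-shift x z (inj₁ z≥0) = begin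
  + ∣ x +ᶻ z ∣          ≤⟨ +≤+ (ℤP.∣i+j∣≤∣i∣+∣j∣ x z) ⟩
  + (∣ x ∣ ℕ.+ ∣ z ∣)   ≡⟨ ℤP.pos-+ ∣ x ∣ ∣ z ∣ ⟩
  + ∣ x ∣ +ᶻ + ∣ z ∣    ≡⟨ cong (+ ∣ x ∣ +ᶻ_) (ℤP.0≤i⇒+∣i∣≡i z≥0) ⟩
  + ∣ x ∣ +ᶻ z          ∎
  where open ℤP.≤-Reasoning
∣+∣-shift x z (inj₂ x+z≥0) = begin
  + ∣ x +ᶻ z ∣  ≡⟨ ℤP.0≤i⇒+∣i∣≡i x+z≥0 ⟩
  x +ᶻ z        ≤⟨ ℤP.+-monoˡ-≤ z (i≤+∣i∣ x) ⟩
  + ∣ x ∣ +ᶻ z  ∎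
  where open ℤP.≤-Reasoning

∣+1∣-negative : ∀ x → x <ᶻ + 0 → + ∣ x +ᶻ + 1 ∣ <ᶻ + ∣ x ∣ +ᶻ + 1
∣+1∣-negative -[1+ zero ]  _ = +<+ (ℕ.s≤s ℕ.z≤n)
∣+1∣-negative -[1+ suc n ] _ = +<+ (ℕ.s≤s (ℕ.s≤s (ℕP.m≤m+n n 1)))
∣+1∣-negative (+ n)        (+<+ ())

ℓ¹-decrease : ∀ {I J} (A Z H : Matrix I J) (a : Fin I) (b : Fin J) →
  (∀ i → sumℤ J (Z i) ≡ + 0) →
  (∀ i j → + ∣ (A i j -ᶻ H i j) +ᶻ Z i j ∣ ≤ᶻ + ∣ A i j -ᶻ H i j ∣ +ᶻ Z i j) →
  + ∣ (A a b -ᶻ H a b) +ᶻ Z a b ∣ <ᶻ + ∣ A a b -ᶻ H a b ∣ +ᶻ Z a b →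
  D (A ⊕ Z) H < D A H
ℓ¹-decrease {I} {J} A Z H a b rows-zero bound bound-strict = ℤP.drop‿+<+ (begin-strict
  + D (A ⊕ Z) H                                ≡⟨ +D (A ⊕ Z) H ⟩
  sumℤ I (λ i → sumℤ J (λ j → + ∣ (A i j +ᶻ Z i j) -ᶻ H i j ∣))
    ≡⟨ sumℤ-cong I (λ i → sumℤ-cong J (λ j → cong (+_ ∘ ∣_∣) (regroup (A i j) (Z i j) (H i j)))) ⟩
  sumℤ I (λ i → sumℤ J (λ j → new i j))       <⟨ sumℤ-< I a (λ i → sumℤ-mono J (bound i))
                                                            (sumℤ-< J b (bound a) bound-strict) ⟩
  sumℤ I (λ i → sumℤ J (λ j → old i j +ᶻ Z i j))
    ≡⟨ sumℤ-cong I (λ i → trans (sumℤ-+ J (old i) (Z i))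
                                (trans (cong (sumℤ J (old i) +ᶻ_) (rows-zero i)) (ℤP.+-identityʳ _))) ⟩
  sumℤ I (λ i → sumℤ J (old i))                ≡⟨ sym (+D A H) ⟩
  + D A H                                      ∎)
  where
  open ℤP.≤-Reasoning
  new old : Fin I → Fin J → ℤ
  new i j = + ∣ (A i j -ᶻ H i j) +ᶻ Z i j ∣
  old i j = + ∣ A i j -ᶻ H i j ∣
  regroup : ∀ a z h → (a +ᶻ z) -ᶻ h ≡ (a -ᶻ h) +ᶻ z
  regroup = solve-∀

elem-formula : ∀ {I J} {a b : Fin I} {c : Fin J} → a ≢ b → ∀ i j →
               elem a b c i j ≡ single c (δ b i -ᶻ δ a i) j
elem-formula {a = a} {b} {c} a≢b i j with j ≟ c
... | no _ = refl
... | yes _ with i ≟ b | i ≟ a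
...   | yes refl | yes refl = ⊥-elim (a≢b refl)
...   | yes _    | no _     = refl
...   | no _     | yes _    = refl
...   | no _     | no _     = refl

elem-row-sum : ∀ {I J} {a b : Fin I} (c : Fin J) → a ≢ b → ∀ i →
               sumℤ J (elem a b c i) ≡ δ b i -ᶻ δ a i
elem-row-sum {J = J} {a} {b} c a≢b i =
  trans (sumℤ-cong J (elem-formula a≢b i)) (sum-single J c _)

elem-column-sum : ∀ {I J} {a b : Fin I} (c : Fin J) → a ≢ b → ∀ j →
                  sumℤ I (λ i → elem a b c i j) ≡ + 0
elem-column-sum {I} {a = a} {b} c a≢b j =
  trans (sumℤ-cong I (λ i → elem-formula a≢b i j)) column
  where
  column : sumℤ I (λ i → single c (δ b i -ᶻ δ a i) j) ≡ + 0
  column with j ≟ c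
  ... | no _  = sumℤ-zero I
  ... | yes _ = trans (sumℤ-- I (δ b) (δ a))
                      (cong₂ _-ᶻ_ (sum-single I b (+ 1)) (sum-single I a (+ 1)))

move-column-sum : ∀ {I J} {Z : Matrix I J} → ColMoveSum Z → ∀ j → sumℤ I (λ i → Z i j) ≡ + 0
move-column-sum {I} none j = sumℤ-zero I
move-column-sum {I} (step {Z} i₁ i₂ c i₁≢i₂ moves) j =
  trans (sumℤ-+ I (λ i → Z i j) (λ i → elem i₁ i₂ c i j))
        (cong₂ _+ᶻ_ (move-column-sum moves j) (elem-column-sum c i₁≢i₂ j))

Balanced : ∀ {I J} → Matrix I J → Set
Balanced {I} {J} Z = (∀ i → sumℤ J (Z i) ≡ + 0) × (∀ j → sumℤ I (λ i → Z i j) ≡ + 0)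

margins-⊕ : ∀ {I J} {r : Fin I → ℕ} {c : Fin J → ℕ} {A Z : Matrix I J} →
            Balanced Z → HasMargins r c A → HasMargins r c (A ⊕ Z)
margins-⊕ {I} {J} {A = A} {Z} (rows , cols) (hr , hc) =
  (λ i → trans (sumℤ-+ J (A i) (Z i))
               (trans (cong₂ _+ᶻ_ (hr i) (rows i)) (ℤP.+-identityʳ _))) ,
  (λ j → trans (sumℤ-+ I (λ i → A i j) (λ i → Z i j))
               (trans (cong₂ _+ᶻ_ (hc j) (cols j)) (ℤP.+-identityʳ _)))

margins-⊖ : ∀ {I J} {r : Fin I → ℕ} {c : Fin J → ℕ} {A Z : Matrix I J} →
            Balanced Z → HasMargins r c A → HasMargins r c (A ⊖ Z)
margins-⊖ {I} {J} {A = A} {Z} (rows , cols) (hr , hc) =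
  (λ i → trans (sumℤ-- J (A i) (Z i))
               (trans (cong₂ _-ᶻ_ (hr i) (rows i)) (ℤP.+-identityʳ _))) ,
  (λ j → trans (sumℤ-- I (λ i → A i j) (λ i → Z i j))
               (trans (cong₂ _-ᶻ_ (hc j) (cols j)) (ℤP.+-identityʳ _)))

0<a-b : ∀ {a b} → b <ᶻ a → + 0 <ᶻ a -ᶻ b
0<a-b {a} {b} b<a = subst (_<ᶻ a -ᶻ b) (ℤP.+-inverseʳ b) (ℤP.+-monoˡ-< (-ᶻ b) b<a)

a-b<0 : ∀ {a b} → a <ᶻ b → a -ᶻ b <ᶻ + 0
a-b<0 {a} {b} a<b = subst (a -ᶻ b <ᶻ_) (ℤP.+-inverseʳ b) (ℤP.+-monoˡ-< (-ᶻ b) a<b)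

0≤pred : ∀ {a} → + 0 <ᶻ a → + 0 ≤ᶻ a +ᶻ -[1+ 0 ]
0≤pred a>0 = ℤP.+-monoˡ-≤ -[1+ 0 ] (ℤP.i<j⇒suc[i]≤j a>0)

0≤+ : ∀ {a b} → + 0 ≤ᶻ a → + 0 ≤ᶻ b → + 0 ≤ᶻ a +ᶻ b
0≤+ = ℤP.+-mono-≤

module Rectangle {I J : ℕ} (i₁ i₂ : Fin I) (j₁ j₂ : Fin J)
                 (i₁≢i₂ : i₁ ≢ i₂) (j₁≢j₂ : j₁ ≢ j₂) where

  -- +1 at (i₁,j₁) and (i₂,j₂), -1 at (i₂,j₁) and (i₁,j₂): two elementary column moves.
  Z : Matrix I J
  Z = ((λ _ _ → + 0) ⊕ elem i₂ i₁ j₁) ⊕ elem i₁ i₂ j₂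

  is-move : ColMoveSum Z
  is-move = step i₁ i₂ j₂ i₁≢i₂ (step i₂ i₁ j₁ (i₁≢i₂ ∘ sym) none)

  balanced : Balanced Z
  balanced = rows , move-column-sum is-move
    where
    cancel : ∀ x y → (+ 0 +ᶻ (x -ᶻ y)) +ᶻ (y -ᶻ x) ≡ + 0
    cancel = solve-∀
    rows : ∀ i → sumℤ J (Z i) ≡ + 0
    rows i = begin
      sumℤ J (Z i)
        ≡⟨ sumℤ-+ J _ (elem i₁ i₂ j₂ i) ⟩
      sumℤ J (λ j → + 0 +ᶻ elem i₂ i₁ j₁ i j) +ᶻ sumℤ J (elem i₁ i₂ j₂ i)
        ≡⟨ cong (_+ᶻ sumℤ J (elem i₁ i₂ j₂ i)) (sumℤ-+ J (λ _ → + 0) (elem i₂ i₁ j₁ i)) ⟩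
      (sumℤ J (λ _ → + 0) +ᶻ sumℤ J (elem i₂ i₁ j₁ i)) +ᶻ sumℤ J (elem i₁ i₂ j₂ i)
        ≡⟨ cong₂ _+ᶻ_ (cong₂ _+ᶻ_ (sumℤ-zero J) (elem-row-sum j₁ (i₁≢i₂ ∘ sym) i))
                      (elem-row-sum j₂ i₁≢i₂ i) ⟩
      (+ 0 +ᶻ (δ i₁ i -ᶻ δ i₂ i)) +ᶻ (δ i₂ i -ᶻ δ i₁ i)
        ≡⟨ cancel (δ i₁ i) (δ i₂ i) ⟩
      + 0 ∎
      where open ≡-Reasoning

  data Corner (i : Fin I) (j : Fin J) : ℤ → Set where
    at₁₁     : i ≡ i₁ → j ≡ j₁ → Corner i j (+ 1)
    at₂₂     : i ≡ i₂ → j ≡ j₂ → Corner i j (+ 1)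
    at₂₁     : i ≡ i₂ → j ≡ j₁ → Corner i j -[1+ 0 ]
    at₁₂     : i ≡ i₁ → j ≡ j₂ → Corner i j -[1+ 0 ]
    off-rows : i ≢ i₁ → i ≢ i₂ → Corner i j (+ 0)
    off-cols : j ≢ j₁ → j ≢ j₂ → Corner i j (+ 0)

  corner : ∀ i j → Corner i j (Z i j)
  corner i j with j ≟ j₁ | j ≟ j₂
  ... | yes p | yes q = ⊥-elim (j₁≢j₂ (trans (sym p) q))
  ... | no p  | no q  = off-cols p q
  ... | yes p | no _ with i ≟ i₁ | i ≟ i₂
  ...   | yes r | _     = at₁₁ r p
  ...   | no _  | yes s = at₂₁ s p
  ...   | no r  | no s  = off-rows r s
  corner i j | no _ | yes q with i ≟ i₂ | i ≟ i₁
  ...   | yes s | _     = at₂₂ s q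
  ...   | no _  | yes r = at₁₂ r q
  ...   | no s  | no r  = off-rows r s

  value₁₁ : ∀ {v} → Corner i₁ j₁ v → v ≡ + 1
  value₁₁ (at₁₁ _ _)     = refl
  value₁₁ (at₂₂ p _)     = ⊥-elim (i₁≢i₂ p)
  value₁₁ (at₂₁ p _)     = ⊥-elim (i₁≢i₂ p)
  value₁₁ (at₁₂ _ q)     = ⊥-elim (j₁≢j₂ q)
  value₁₁ (off-rows p _) = ⊥-elim (p refl)
  value₁₁ (off-cols p _) = ⊥-elim (p refl)

  value₂₂ : ∀ {v} → Corner i₂ j₂ v → v ≡ + 1
  value₂₂ (at₁₁ p _)     = ⊥-elim (i₁≢i₂ (sym p))
  value₂₂ (at₂₂ _ _)     = refl
  value₂₂ (at₂₁ _ q)     = ⊥-elim (j₁≢j₂ (sym q))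
  value₂₂ (at₁₂ p _)     = ⊥-elim (i₁≢i₂ (sym p))
  value₂₂ (off-rows _ q) = ⊥-elim (q refl)
  value₂₂ (off-cols _ q) = ⊥-elim (q refl)

  add-nonneg : (A : Matrix I J) → (∀ i j → + 0 ≤ᶻ A i j) →
               + 0 <ᶻ A i₂ j₁ → + 0 <ᶻ A i₁ j₂ → ∀ i j → + 0 ≤ᶻ (A ⊕ Z) i j
  add-nonneg A A≥0 pos₂₁ pos₁₂ i j = cell (corner i j)
    where
    cell : ∀ {v} → Corner i j v → + 0 ≤ᶻ A i j +ᶻ v
    cell (at₁₁ _ _)       = 0≤+ (A≥0 i j) (+≤+ ℕ.z≤n)
    cell (at₂₂ _ _)       = 0≤+ (A≥0 i j) (+≤+ ℕ.z≤n)
    cell (at₂₁ refl refl) = 0≤pred pos₂₁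
    cell (at₁₂ refl refl) = 0≤pred pos₁₂
    cell (off-rows _ _)   = 0≤+ (A≥0 i j) ℤP.≤-refl
    cell (off-cols _ _)   = 0≤+ (A≥0 i j) ℤP.≤-refl

  sub-nonneg : (B : Matrix I J) → (∀ i j → + 0 ≤ᶻ B i j) → + 0 <ᶻ B i₁ j₁ →
               ∀ i j → (i ≡ i₂ → j ≡ j₂ → + 0 <ᶻ B i₂ j₂) → + 0 ≤ᶻ (B ⊖ Z) i j
  sub-nonneg B B≥0 pos₁₁ i j pos₂₂ = cell (corner i j)
    where
    cell : ∀ {v} → Corner i j v → + 0 ≤ᶻ B i j -ᶻ v
    cell (at₁₁ refl refl) = 0≤pred pos₁₁
    cell (at₂₂ refl refl) = 0≤pred (pos₂₂ refl refl)
    cell (at₂₁ _ _)       = 0≤+ (B≥0 i j) (+≤+ ℕ.z≤n)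
    cell (at₁₂ _ _)       = 0≤+ (B≥0 i j) (+≤+ ℕ.z≤n)
    cell (off-rows _ _)   = 0≤+ (B≥0 i j) ℤP.≤-refl
    cell (off-cols _ _)   = 0≤+ (B≥0 i j) ℤP.≤-refl

  abs-bound : (X : Matrix I J) → + 0 <ᶻ X i₂ j₁ → + 0 <ᶻ X i₁ j₂ →
              ∀ i j → + ∣ X i j +ᶻ Z i j ∣ ≤ᶻ + ∣ X i j ∣ +ᶻ Z i j
  abs-bound X pos₂₁ pos₁₂ i j = ∣+∣-shift (X i j) (Z i j) (cell (corner i j))
    where
    cell : ∀ {v} → Corner i j v → + 0 ≤ᶻ v ⊎ + 0 ≤ᶻ X i j +ᶻ v
    cell (at₁₁ _ _)       = inj₁ (+≤+ ℕ.z≤n)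
    cell (at₂₂ _ _)       = inj₁ (+≤+ ℕ.z≤n)
    cell (at₂₁ refl refl) = inj₂ (0≤pred pos₂₁)
    cell (at₁₂ refl refl) = inj₂ (0≤pred pos₁₂)
    cell (off-rows _ _)   = inj₁ ℤP.≤-refl
    cell (off-cols _ _)   = inj₁ ℤP.≤-refl

  closer : (A H : Matrix I J) → A i₁ j₁ <ᶻ H i₁ j₁ → H i₂ j₁ <ᶻ A i₂ j₁ →
           H i₁ j₂ <ᶻ A i₁ j₂ → D (A ⊕ Z) H < D A H
  closer A H below₁₁ above₂₁ above₁₂ =
    ℓ¹-decrease A Z H i₁ j₁ (proj₁ balanced)
      (abs-bound (A ⊖ H) (0<a-b above₂₁) (0<a-b above₁₂))
      (subst (λ v → + ∣ (A i₁ j₁ -ᶻ H i₁ j₁) +ᶻ v ∣ <ᶻ + ∣ A i₁ j₁ -ᶻ H i₁ j₁ ∣ +ᶻ v)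
             (sym (value₁₁ (corner i₁ j₁)))
             (∣+1∣-negative _ (a-b<0 below₁₁)))

module _ {I J N : ℕ} (P : Fin N → Matrix I J) (k k₂ : Fin N) (Z : Matrix I J) where

  swap-at-k : swap P k k₂ Z k ≡ P k ⊕ Z
  swap-at-k with k ≟ k
  ... | yes _  = refl
  ... | no k≢k = ⊥-elim (k≢k refl)

  swap-at-k₂ : k₂ ≢ k → swap P k k₂ Z k₂ ≡ P k₂ ⊖ Z
  swap-at-k₂ k₂≢k with k₂ ≟ k
  ... | yes k₂≡k = ⊥-elim (k₂≢k k₂≡k)
  ... | no _ with k₂ ≟ k₂
  ...   | yes _    = refl
  ...   | no k₂≢k₂ = ⊥-elim (k₂≢k₂ refl)

  swap-preserves : (Q : Fin N → Matrix I J → Set) → Q k (P k ⊕ Z) → Q k₂ (P k₂ ⊖ Z) →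
                   (∀ l → Q l (P l)) → ∀ l → Q l (swap P k k₂ Z l)
  swap-preserves Q new-k new-k₂ old l with l ≟ k
  ... | yes refl = new-k
  ... | no _ with l ≟ k₂
  ...   | yes refl = new-k₂
  ...   | no _     = old l

  swap-total : k₂ ≢ k → ∀ i j → sumMat N (swap P k k₂ Z) i j ≡ sumMat N P i j
  swap-total k₂≢k i j = begin
    sumℤ N (λ l → swap P k k₂ Z l i j)
      ≡⟨ sumℤ-cong N entry ⟩
    sumℤ N (λ l → P l i j +ᶻ (single k (Z i j) l -ᶻ single k₂ (Z i j) l))
      ≡⟨ sumℤ-+ N (λ l → P l i j) _ ⟩
    sumMat N P i j +ᶻ sumℤ N (λ l → single k (Z i j) l -ᶻ single k₂ (Z i j) l)
      ≡⟨ cong (sumMat N P i j +ᶻ_)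
              (trans (sumℤ-- N (single k (Z i j)) (single k₂ (Z i j)))
                     (trans (cong₂ _-ᶻ_ (sum-single N k (Z i j)) (sum-single N k₂ (Z i j)))
                            (ℤP.+-inverseʳ (Z i j)))) ⟩
    sumMat N P i j +ᶻ + 0
      ≡⟨ ℤP.+-identityʳ _ ⟩
    sumMat N P i j ∎
    where
    open ≡-Reasoning
    entry : ∀ l → swap P k k₂ Z l i j ≡ P l i j +ᶻ (single k (Z i j) l -ᶻ single k₂ (Z i j) l)
    entry l with l ≟ k
    ... | yes refl = sym (trans (cong (λ w → P l i j +ᶻ (Z i j -ᶻ w)) (single-away (Z i j) (k₂≢k ∘ sym)))
                                (cong (P l i j +ᶻ_) (ℤP.+-identityʳ (Z i j))))
    ... | no _ with l ≟ k₂
    ...   | yes refl = cong (P l i j +ᶻ_) (sym (ℤP.+-identityˡ (-ᶻ Z i j)))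
    ...   | no _     = sym (ℤP.+-identityʳ (P l i j))

ImprovingSwap : ∀ {I J N} → (Fin I → ℕ) → (Fin J → ℕ) → (Fin N → Matrix I J) →
                Fin N → Matrix I J → Set
ImprovingSwap r c P k H =
  ∃[ k₂ ] ∃[ Z ] (k₂ ≢ k × ColMoveSum Z × D (swap P k k₂ Z k) H < D (P k) H ×
    (¬ ProperMS r c (swap P k k₂ Z) →
      ∃[ kim ] ∃[ i* ] ∃[ j* ] (ImproperMS r c (swap P k k₂ Z) kim i* j* ×
        Resolvable (swap P k k₂ Z) kim i* j* k)))

swap-outcome : ∀ {I J N} (r : Fin I → ℕ) (c : Fin J → ℕ) (P : Fin N → Matrix I J)
  (k k₂ : Fin N) (Z : Matrix I J) (i* : Fin I) (j* : Fin J) → k₂ ≢ k → ProperMS r c P →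
  Proper r c (P k ⊕ Z) → Proper r c (P k₂ ⊖ Z) ⊎ Improper r c (P k₂ ⊖ Z) i* j* →
  + 0 <ᶻ (P k ⊕ Z) i* j* →
  ¬ ProperMS r c (swap P k k₂ Z) →
  ∃[ kim ] ∃[ i* ] ∃[ j* ] (ImproperMS r c (swap P k k₂ Z) kim i* j* ×
    Resolvable (swap P k k₂ Z) kim i* j* k)
swap-outcome r c P k k₂ Z i* j* k₂≢k proper k-proper (inj₁ k₂-proper) _ not-proper =
  ⊥-elim (not-proper (swap-preserves P k k₂ Z (λ _ → Proper r c) k-proper k₂-proper proper))
swap-outcome {N = N} r c P k k₂ Z i* j* k₂≢k proper k-proper (inj₂ k₂-improper) k-positive _ =
  k₂ , i* , j* , (improper , others-proper , total-nonneg) , k₂≢k ∘ sym , resolvable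
  where
  improper : Improper r c (swap P k k₂ Z k₂) i* j*
  improper = subst (λ M → Improper r c M i* j*) (sym (swap-at-k₂ P k k₂ Z k₂≢k)) k₂-improper
  others-proper : ∀ l → l ≢ k₂ → Proper r c (swap P k k₂ Z l)
  others-proper = swap-preserves P k k₂ Z (λ l M → l ≢ k₂ → Proper r c M)
                    (λ _ → k-proper) (λ k₂≢k₂ → ⊥-elim (k₂≢k₂ refl)) (λ l _ → proper l)
  total-nonneg : ∀ i j → + 0 ≤ᶻ sumMat N (swap P k k₂ Z) i j
  total-nonneg i j =
    subst (+ 0 ≤ᶻ_) (sym (swap-total P k k₂ Z k₂≢k i j))
          (ℤP.≤-trans (ℤP.≤-reflexive (sym (sumℤ-zero N)))
                      (sumℤ-mono N (λ l → proj₂ (proper l) i j)))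
  resolvable : + 0 <ᶻ swap P k k₂ Z k i* j*
  resolvable = subst (λ M → + 0 <ᶻ M i* j*) (sym (swap-at-k P k k₂ Z)) k-positive

rectangle-swap : ∀ {I J N} (r : Fin I → ℕ) (c : Fin J → ℕ) (P : Fin N → Matrix I J)
  (H : Matrix I J) → ProperMS r c P → (∀ i j → + 0 ≤ᶻ H i j) →
  (k k₂ : Fin N) (i₁ i₂ : Fin I) (j₁ j₂ : Fin J) → k₂ ≢ k →
  P k i₁ j₁ <ᶻ H i₁ j₁ → H i₂ j₁ <ᶻ P k i₂ j₁ → H i₁ j₂ <ᶻ P k i₁ j₂ →
  + 0 <ᶻ P k₂ i₁ j₁ → ImprovingSwap r c P k H
rectangle-swap r c P H proper H≥0 k k₂ i₁ i₂ j₁ j₂ k₂≢k below₁₁ above₂₁ above₁₂ donor =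
  k₂ , Z , k₂≢k , is-move , nearer ,
  swap-outcome r c P k k₂ Z i₂ j₂ k₂≢k proper k-proper k₂-after k-positive
  where
  i₁≢i₂ : i₁ ≢ i₂
  i₁≢i₂ i₁≡i₂ = ℤP.<-asym below₁₁ (subst (λ i → H i j₁ <ᶻ P k i j₁) (sym i₁≡i₂) above₂₁)
  j₁≢j₂ : j₁ ≢ j₂
  j₁≢j₂ j₁≡j₂ = ℤP.<-asym below₁₁ (subst (λ j → H i₁ j <ᶻ P k i₁ j) (sym j₁≡j₂) above₁₂)
  open Rectangle i₁ i₂ j₁ j₂ i₁≢i₂ j₁≢j₂
  nonneg : ∀ l i j → + 0 ≤ᶻ P l i j
  nonneg l = proj₂ (proper l)
  nearer : D (swap P k k₂ Z k) H < D (P k) H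
  nearer = subst (λ M → D M H < D (P k) H) (sym (swap-at-k P k k₂ Z))
                 (closer (P k) H below₁₁ above₂₁ above₁₂)
  k-proper : Proper r c (P k ⊕ Z)
  k-proper = margins-⊕ balanced (proj₁ (proper k)) ,
             add-nonneg (P k) (nonneg k) (ℤP.≤-<-trans (H≥0 i₂ j₁) above₂₁)
                                         (ℤP.≤-<-trans (H≥0 i₁ j₂) above₁₂)
  k-positive : + 0 <ᶻ (P k ⊕ Z) i₂ j₂
  k-positive = subst (λ v → + 0 <ᶻ P k i₂ j₂ +ᶻ v) (sym (value₂₂ (corner i₂ j₂)))
                     (ℤP.+-mono-≤-< (nonneg k i₂ j₂) (+<+ (ℕ.s≤s ℕ.z≤n)))
  k₂-after : Proper r c (P k₂ ⊖ Z) ⊎ Improper r c (P k₂ ⊖ Z) i₂ j₂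
  k₂-after with + 0 ℤP.<? P k₂ i₂ j₂
  ... | yes pos₂₂ = inj₁ (margins-⊖ balanced (proj₁ (proper k₂)) ,
                          λ i j → sub-nonneg (P k₂) (nonneg k₂) donor i j (λ _ _ → pos₂₂))
  ... | no ¬pos₂₂ = inj₂ (margins-⊖ balanced (proj₁ (proper k₂)) ,
                          cong₂ _-ᶻ_ empty₂₂ (value₂₂ (corner i₂ j₂)) ,
                          λ i j off → sub-nonneg (P k₂) (nonneg k₂) donor i j
                                        (λ p q → ⊥-elim (off (p , q))))
    where
    empty₂₂ : P k₂ i₂ j₂ ≡ + 0
    empty₂₂ = ℤP.≤-antisym (ℤP.≮⇒≥ ¬pos₂₂) (nonneg k₂ i₂ j₂)

deficient-entry : ∀ {I J} (A H : Matrix I J) →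
  (∀ j → sumℤ I (λ i → A i j) ≡ sumℤ I (λ i → H i j)) →
  ¬ (∀ i j → A i j ≡ H i j) → ∃[ i ] ∃[ j ] A i j <ᶻ H i j
deficient-entry {I} {J} A H same-columns A≢H =
  let (i , row-differs) = FinP.¬∀⟶∃¬ I (λ i → ∀ j → A i j ≡ H i j)
                            (λ i → FinP.all? (λ j → A i j ℤP.≟ H i j)) A≢H
      (j , entry-differs) = FinP.¬∀⟶∃¬ J (λ j → A i j ≡ H i j)
                              (λ j → A i j ℤP.≟ H i j) row-differs
  in compare i j entry-differs
  where
  compare : ∀ i j → A i j ≢ H i j → ∃[ i ] ∃[ j ] A i j <ᶻ H i j
  compare i j A≢H-ij with ℤP.<-cmp (A i j) (H i j)
  ... | tri< A<H _ _ = i , j , A<H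
  ... | tri≈ _ A≡H _ = ⊥-elim (A≢H-ij A≡H)
  ... | tri> _ _ A>H =
    let (i′ , A<H) = compensating-index I (λ i → H i j) (λ i → A i j) i
                                        (sym (same-columns j)) A>H
    in i′ , j , A<H

lemma4p9 : ∀ {I J N} (r : Fin I → ℕ) (c : Fin J → ℕ) →
    sumℕ I r ≡ sumℕ J c →
    (P P̂ : Fin N → Matrix I J) →
    ProperMS r c P → ProperMS r c P̂ →
    (∀ i j → sumMat N P i j ≡ sumMat N P̂ i j) →
    (k k′ : Fin N) → ¬ (∀ i j → P k i j ≡ P̂ k′ i j) →
    ∃[ k₂ ] ∃[ Z ] (k₂ ≢ k × ColMoveSum Z ×
      D (swap P k k₂ Z k) (P̂ k′) < D (P k) (P̂ k′) ×
      (¬ ProperMS r c (swap P k k₂ Z) →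
        ∃[ kim ] ∃[ i* ] ∃[ j* ] (ImproperMS r c (swap P k k₂ Z) kim i* j* ×
          Resolvable (swap P k k₂ Z) kim i* j* k)))
lemma4p9 {I} {J} {N} r c _ P P̂ proper proper̂ same-total k k′ differ =
  let H = P̂ k′
      same-rows : ∀ i → sumℤ J (P k i) ≡ sumℤ J (H i)
      same-rows i = trans (proj₁ (proj₁ (proper k)) i) (sym (proj₁ (proj₁ (proper̂ k′)) i))
      same-columns : ∀ j → sumℤ I (λ i → P k i j) ≡ sumℤ I (λ i → H i j)
      same-columns j = trans (proj₂ (proj₁ (proper k)) j) (sym (proj₂ (proj₁ (proper̂ k′)) j))
      (i₁ , j₁ , below₁₁) = deficient-entry (P k) H same-columns differ
      (i₂ , above₂₁) = compensating-index I (λ i → P k i j₁) (λ i → H i j₁) i₁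
                                          (same-columns j₁) below₁₁
      (j₂ , above₁₂) = compensating-index J (P k i₁) (H i₁) j₁ (same-rows i₁) below₁₁
      -- graph k holds less than the common total at (i₁,j₁), so another graph is positive there
      (k₂ , k₂≢k , donor) = positive-other N (λ l → P l i₁ j₁) k
        (ℤP.<-≤-trans below₁₁ (ℤP.≤-trans (≤-sum N (λ l → P̂ l i₁ j₁) k′ (λ l → proj₂ (proper̂ l) i₁ j₁))
                                          (ℤP.≤-reflexive (sym (same-total i₁ j₁)))))
  in rectangle-swap r c P H proper (proj₂ (proper̂ k′)) k k₂ i₁ i₂ j₁ j₂ k₂≢k
                    below₁₁ above₂₁ above₁₂ donor
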